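{- Let $D$ be a diagram with nonempty columns $c_1<\cdots<c_n$, and suppose column $c_i$ of $D$ contains $n_i$ cells for $i\in[n]$. Then \[\max\{|\mathrm{empty}(\tilde D)| : \tilde D\in\mathrm{Min}(D)\}=\sum_{i=1}^n\bigl(h(D,c_i)-n_i\bigr).\]
   Context: A diagram is a finite subset $D\subset\mathbb{Z}_{>0}\times\mathbb{Z}_{>0}$; $(r,c)\in D$ is a cell in row $r$, column $c$. $\mathrm{empty}(D)=\{(r,c)\notin D : \exists\,\tilde r>r \text{ with } (\tilde r,c)\in D\}$. Kohnert move at row $r$: if row $r$ is empty, $\mathcal{K}(D,r)=D$; otherwise let $(r,c)$ be the rightmost cell of row $r$; if some $r'<r$ has $(r',c)\notin D$, take the largest such $r'$ and set $\mathcal{K}(D,r)=(D\setminus\{(r,c)\})\cup\{(r',c)\}$; else $\mathcal{K}(D,r)=D$. $\mathrm{KD}(D)$ is the set of diagrams obtainable from $D$ by finite sequences of Kohnert moves, and $\mathrm{Min}(D)=\{\tilde D\in\mathrm{KD}(D):\mathcal{K}(\tilde D,r)=\tilde D\ \forall r\}$. For a nonempty column $c$ of $D$: let $m_c$ be the number of cells in column $c$, $M$ the maximum number of cells in a column of $D$ strictly to the right of $c$ ($M=0$ if none), and $r$ the row of the topmost cell of column $c$ in $D$; define $h(D,c)=r$ if $M\ge r$, $h(D,c)=m_c$ if $m_c\ge M$, and $h(D,c)=M$ if $r>M>m_c$. -}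

module Defs where

open import Data.Nat using (ℕ; zero; suc; _⊔_; _≤_; _<ᵇ_; _≡ᵇ_; _∸_; _≤ᵇ_)
open import Data.Bool using (Bool; true; false; if_then_else_; not; _∧_; _∨_)
open import Data.Product using (_×_; _,_; proj₁; proj₂)
open import Data.List using (List; []; _∷_; map; foldr; upTo; length)
open import Data.Nat.ListAction using (sum)
open import Data.List.Relation.Unary.All using (All)
open import Data.Maybe using (Maybe; just; nothing)
open import Relation.Binary.PropositionalEquality using (_≡_)

-- A diagram is a finite set of cells (r , c) = (row , column), given as a list;
-- only the membership relation matters (duplicates / order are irrelevant).
Cell : Set
Cell = ℕ × ℕ

Diagram : Set
Diagram = List Cell

Positive : Diagram → Set
Positive D = All (λ x → 1 ≤ proj₁ x × 1 ≤ proj₂ x) D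

boolFilter : {A : Set} → (A → Bool) → List A → List A
boolFilter p [] = []
boolFilter p (x ∷ xs) = if p x then x ∷ boolFilter p xs else boolFilter p xs

any : {A : Set} → (A → Bool) → List A → Bool
any p [] = false
any p (x ∷ xs) = p x ∨ any p xs

mem : Diagram → ℕ → ℕ → Bool
mem D r c = any (λ x → (proj₁ x ≡ᵇ r) ∧ (proj₂ x ≡ᵇ c)) D

_≈D_ : Diagram → Diagram → Set
D ≈D E = ∀ r c → mem D r c ≡ mem E r c

bnd : Diagram → ℕ
bnd D = foldr (λ x acc → proj₁ x ⊔ proj₂ x ⊔ acc) 0 D

range1 : ℕ → List ℕ
range1 n = map suc (upTo n)

maxL : List ℕ → ℕ
maxL = foldr _⊔_ 0

countB : {A : Set} → (A → Bool) → List A → ℕ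
countB p xs = length (boolFilter p xs)

findFree : Diagram → ℕ → ℕ → Maybe ℕ
findFree D c zero = nothing
findFree D c (suc k) = if mem D (suc k) c then findFree D c k else just (suc k)

rowCols : Diagram → ℕ → List ℕ
rowCols D r = map proj₂ (boolFilter (λ x → proj₁ x ≡ᵇ r) D)

moveCell : Diagram → ℕ → ℕ → Maybe ℕ → Diagram
moveCell D r c nothing = D
moveCell D r c (just r') =
  (r' , c) ∷ boolFilter (λ x → not ((proj₁ x ≡ᵇ r) ∧ (proj₂ x ≡ᵇ c))) D

K : Diagram → ℕ → Diagram
K D r with rowCols D r
... | [] = D
... | cs@(_ ∷ _) = moveCell D r (maxL cs) (findFree D (maxL cs) (r ∸ 1))

data Reach (D : Diagram) : Diagram → Set where
  here : Reach D D
  step : ∀ {E} → Reach D E → (r : ℕ) → Reach D (K E r)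

-- E is fixed by every Kohnert move (E ∈ Min(D) when also Reach D E)
IsMin : Diagram → Set
IsMin E = ∀ r → K E r ≈D E

isEmptyCell : Diagram → ℕ → ℕ → Bool
isEmptyCell D r c =
  not (mem D r c) ∧ any (λ r̃ → (r <ᵇ r̃) ∧ mem D r̃ c) (range1 (bnd D))

emptyCount : Diagram → ℕ
emptyCount D =
  sum (map (λ c → countB (λ r → isEmptyCell D r c) (range1 (bnd D))) (range1 (bnd D)))

colCount : Diagram → ℕ → ℕ
colCount D c = countB (λ r → mem D r c) (range1 (bnd D))

topRow : Diagram → ℕ → ℕ
topRow D c = maxL (boolFilter (λ r → mem D r c) (range1 (bnd D)))

maxRight : Diagram → ℕ → ℕ
maxRight D c = maxL (map (colCount D) (boolFilter (λ c' → c <ᵇ c') (range1 (bnd D))))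

h : Diagram → ℕ → ℕ
h D c =
  if topRow D c ≤ᵇ maxRight D c then topRow D c
  else (if maxRight D c ≤ᵇ colCount D c then colCount D c else maxRight D c)

-- nonempty columns c₁ < ⋯ < cₙ are exactly the c ∈ [1, bnd D] with colCount D c ≠ 0
nonemptyCols : Diagram → List ℕ
nonemptyCols D = boolFilter (λ c → 1 ≤ᵇ colCount D c) (range1 (bnd D))

hSum : Diagram → ℕ
hSum D = sum (map (λ c → h D c ∸ colCount D c) (nonemptyCols D))

{-# OPTIONS --safe #-}
-- Kohnert moves keep the number n_c of cells in every column c and never lift a
-- cell above the top row r of its column in D, and the empty cells of a diagram
-- are counted column by column as (height of the column) − n_c.  So it suffices to
-- show that in every minimal Kohnert diagram each column c has height at most
-- h(D,c), with equality for all c in one of them.  As n_c ≤ r, h(D,c) = min(r, max(n_c, M)).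
--
-- Upper bound: let the top cell of column c lie in row T.  The rightmost cell of
-- row T, in a column c′ ≥ c, cannot move, so column c′ is full in rows 1, …, T;
-- hence T ≤ n_c′, which is n_c or at most M, and also T ≤ r.
--
-- Attainment: starting from D, always apply the move at the highest row t that is
-- not stuck, say to the cell of column c.  As every row above t is stuck, the
-- columns c′ ≥ c have all their cells in rows ≤ t with a gap among them (column c
-- where the cell lands, the others in row t), so n_c, M < t and h(D,c) ≤ t − 1;
-- and after the move row t − 1 of column c is occupied.  Hence every column keeps
-- a cell in some row ≥ h(D,c).  The sum of all rows decreases, so this ends in a
-- minimal diagram.
module Submission where

open import Defs
open import Data.Bool using (Bool; true; false; if_then_else_; not; _∧_; _∨_; T)
open import Data.Bool.Properties using (∨-zeroʳ; ∨-identityʳ; ∧-identityʳ; ∧-zeroʳ; ¬-not; T-≡)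
open import Data.Empty using (⊥-elim)
open import Data.List using ([]; _∷_; map; _++_; upTo; length)
open import Data.List.Membership.Propositional using (_∈_)
open import Data.List.Membership.Propositional.Properties using (∈-map⁺; ∈-map⁻; ∈-upTo⁺)
open import Data.List.Properties using (map-++; upTo-∷ʳ; length-++)
open import Data.List.Relation.Unary.Any using (here; there)
open import Data.List.Relation.Unary.Any.Properties using (¬Any[])
open import Data.Maybe using (just; nothing)
open import Data.Nat
open import Data.Nat.Induction using (<-wellFounded)
open import Data.Nat.ListAction using (sum)
open import Data.Nat.ListAction.Properties using (sum-++)
open import Data.Nat.Properties
open import Data.Product using (Σ; ∃-syntax; _×_; _,_; proj₁; proj₂)
open import Data.Sum using (_⊎_; inj₁; inj₂)
open import Function using (_∘′_; case_of_; Equivalence)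
open import Induction.WellFounded using (Acc; acc)
open import Relation.Binary.PropositionalEquality
open import Relation.Nullary using (yes; no)

≡ᵇ≡true⇒≡ : ∀ {m n} → (m ≡ᵇ n) ≡ true → m ≡ n
≡ᵇ≡true⇒≡ {m} {n} e = ≡ᵇ⇒≡ m n (Equivalence.from T-≡ e)

≡⇒≡ᵇ≡true : ∀ {m n} → m ≡ n → (m ≡ᵇ n) ≡ true
≡⇒≡ᵇ≡true {m} {n} e = Equivalence.to T-≡ (≡⇒≡ᵇ m n e)

≢⇒≡ᵇ≡false : ∀ {m n} → m ≢ n → (m ≡ᵇ n) ≡ false
≢⇒≡ᵇ≡false m≢n = ¬-not (m≢n ∘′ ≡ᵇ≡true⇒≡)

<ᵇ≡true⇒< : ∀ {m n} → (m <ᵇ n) ≡ true → m < n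
<ᵇ≡true⇒< {m} {n} e = <ᵇ⇒< m n (Equivalence.from T-≡ e)

<⇒<ᵇ≡true : ∀ {m n} → m < n → (m <ᵇ n) ≡ true
<⇒<ᵇ≡true m<n = Equivalence.to T-≡ (<⇒<ᵇ m<n)

≥⇒<ᵇ≡false : ∀ {m n} → n ≤ m → (m <ᵇ n) ≡ false
≥⇒<ᵇ≡false n≤m = ¬-not (λ e → <⇒≱ (<ᵇ≡true⇒< e) n≤m)

≤ᵇ≡true⇒≤ : ∀ {m n} → (m ≤ᵇ n) ≡ true → m ≤ n
≤ᵇ≡true⇒≤ {m} {n} e = ≤ᵇ⇒≤ m n (Equivalence.from T-≡ e)

≤ᵇ≡false⇒> : ∀ {m n} → (m ≤ᵇ n) ≡ false → n < m
≤ᵇ≡false⇒> e = ≰⇒> (λ m≤n → subst T e (≤⇒≤ᵇ m≤n))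

1≤m≤pred[n]⇒m<n : ∀ {m n} → 1 ≤ m → m ≤ pred n → m < n
1≤m≤pred[n]⇒m<n {n = suc n} _   m≤n = s≤s m≤n
1≤m≤pred[n]⇒m<n {n = zero}  1≤m m≤0 = ⊥-elim (<⇒≱ 1≤m m≤0)

pred[n]<n : ∀ {m n} → m < n → pred n < n
pred[n]<n {n = suc n} _ = ≤-refl

everywhere⊎highest : ∀ {P Q : ℕ → Set} → (∀ s → P s ⊎ Q s) → ∀ b → (∀ {s} → b < s → P s) →
                     (∀ s → P s) ⊎ (∃[ t ] Q t × (∀ {s} → t < s → P s))
everywhere⊎highest classify zero above with classify zero
... | inj₁ p = inj₁ λ { zero → p ; (suc s) → above (s≤s z≤n) }
... | inj₂ q = inj₂ (zero , q , above)
everywhere⊎highest {P} classify (suc b) above with classify (suc b)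
... | inj₂ q = inj₂ (suc b , q , above)
... | inj₁ p = everywhere⊎highest classify b above′
  where
  above′ : ∀ {s} → b < s → P s
  above′ {s} b<s with s ≟ suc b
  ... | yes refl = p
  ... | no s≢1+b = above (≤∧≢⇒< b<s (s≢1+b ∘′ sym))

h-formula : ∀ {t m k} → k ≤ t → (if t ≤ᵇ m then t else (if m ≤ᵇ k then k else m)) ≡ t ⊓ (k ⊔ m)
h-formula {t} {m} {k} k≤t with t ≤ᵇ m in t≤ᵇm
... | true = sym (m≤n⇒m⊓n≡m (≤-trans (≤ᵇ≡true⇒≤ t≤ᵇm) (m≤n⊔m k m)))
... | false with m ≤ᵇ k in m≤ᵇk
...   | true  = trans (sym (m≥n⇒m⊓n≡n k≤t)) (cong (t ⊓_) (sym (m≥n⇒m⊔n≡m (≤ᵇ≡true⇒≤ m≤ᵇk))))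
...   | false = trans (sym (m≥n⇒m⊓n≡n (<⇒≤ (≤ᵇ≡false⇒> t≤ᵇm))))
                      (cong (t ⊓_) (sym (m≤n⇒m⊔n≡n (<⇒≤ (≤ᵇ≡false⇒> m≤ᵇk)))))

-- Counting over 1, …, n

count : (ℕ → Bool) → ℕ → ℕ
count p zero    = 0
count p (suc n) = if p (suc n) then suc (count p n) else count p n

greatest : (ℕ → Bool) → ℕ → ℕ
greatest p zero    = 0
greatest p (suc n) = if p (suc n) then suc n else greatest p n

sumTo : (ℕ → ℕ) → ℕ → ℕ
sumTo f zero    = 0
sumTo f (suc n) = sumTo f n + f (suc n)

gaps : (ℕ → Bool) → ℕ → ℕ
gaps p n = greatest p n ∸ count p n

BoundedBy : (ℕ → Bool) → ℕ → Set
BoundedBy p b = ∀ {r} → p r ≡ true → r ≤ b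

Stationary : (ℕ → ℕ) → ℕ → Set
Stationary f b = ∀ {n} → b ≤ n → f (suc n) ≡ f n

stationary⇒constant : ∀ f {b} → Stationary f b → ∀ {n} → b ≤ n → f n ≡ f b
stationary⇒constant f steady {zero} z≤n = refl
stationary⇒constant f {b} steady {suc n} b≤1+n with b ≟ suc n
... | yes refl = refl
... | no b≢1+n = trans (steady b≤n) (stationary⇒constant f steady b≤n)
  where b≤n = s≤s⁻¹ (≤∧≢⇒< b≤1+n b≢1+n)

stationary-agree : ∀ f {b₁ b₂} → Stationary f b₁ → Stationary f b₂ → f b₁ ≡ f b₂
stationary-agree f {b₁} {b₂} steady₁ steady₂ with ≤-total b₁ b₂
... | inj₁ b₁≤b₂ = sym (stationary⇒constant f steady₁ b₁≤b₂)
... | inj₂ b₂≤b₁ = stationary⇒constant f steady₂ b₂≤b₁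

count-stationary : ∀ {p b} → BoundedBy p b → Stationary (count p) b
count-stationary {p} bounded {n} b≤n with p (suc n) in e
... | true  = ⊥-elim (<⇒≱ (s≤s b≤n) (bounded e))
... | false = refl

greatest-stationary : ∀ {p b} → BoundedBy p b → Stationary (greatest p) b
greatest-stationary {p} bounded {n} b≤n with p (suc n) in e
... | true  = ⊥-elim (<⇒≱ (s≤s b≤n) (bounded e))
... | false = refl

gaps-stationary : ∀ {p b} → BoundedBy p b → Stationary (gaps p) b
gaps-stationary bounded b≤n = cong₂ _∸_ (greatest-stationary bounded b≤n) (count-stationary bounded b≤n)

sumTo-stationary : ∀ {f b} → (∀ {c} → b < c → f c ≡ 0) → Stationary (sumTo f) b
sumTo-stationary {f} vanish {n} b≤n =
  trans (cong (sumTo f n +_) (vanish (s≤s b≤n))) (+-identityʳ (sumTo f n))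

count-cong : ∀ {p q} n → (∀ {r} → 1 ≤ r → r ≤ n → p r ≡ q r) → count p n ≡ count q n
count-cong zero _ = refl
count-cong (suc n) p≗q
  rewrite p≗q (s≤s z≤n) ≤-refl | count-cong n (λ 1≤r r≤n → p≗q 1≤r (m≤n⇒m≤1+n r≤n)) = refl

sumTo-cong : ∀ {f g} n → (∀ c → f c ≡ g c) → sumTo f n ≡ sumTo g n
sumTo-cong zero    _   = refl
sumTo-cong (suc n) f≗g = cong₂ _+_ (sumTo-cong n f≗g) (f≗g (suc n))

sumTo-mono : ∀ {f g} n → (∀ c → f c ≤ g c) → sumTo f n ≤ sumTo g n
sumTo-mono zero    _   = z≤n
sumTo-mono (suc n) f≤g = +-mono-≤ (sumTo-mono n f≤g) (f≤g (suc n))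

count≤ : ∀ p n → count p n ≤ n
count≤ p zero = z≤n
count≤ p (suc n) with p (suc n)
... | true  = s≤s (count≤ p n)
... | false = m≤n⇒m≤1+n (count≤ p n)

count-mono : ∀ p {m n} → m ≤ n → count p m ≤ count p n
count-mono p {m} {n} m≤n with m≤n⇒m<n∨m≡n m≤n
... | inj₂ refl = ≤-refl
count-mono p {m} {suc n} _ | inj₁ m<1+n with p (suc n)
... | true  = m≤n⇒m≤1+n (count-mono p (s≤s⁻¹ m<1+n))
... | false = count-mono p (s≤s⁻¹ m<1+n)

greatest≤ : ∀ p n → greatest p n ≤ n
greatest≤ p zero = z≤n
greatest≤ p (suc n) with p (suc n)
... | true  = ≤-refl
... | false = m≤n⇒m≤1+n (greatest≤ p n)

count≤greatest : ∀ p n → count p n ≤ greatest p n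
count≤greatest p zero = z≤n
count≤greatest p (suc n) with p (suc n)
... | true  = s≤s (count≤ p n)
... | false = count≤greatest p n

greatest-holds : ∀ p n → 1 ≤ greatest p n → p (greatest p n) ≡ true
greatest-holds p (suc n) 1≤g with p (suc n) in e
... | true  = e
... | false = greatest-holds p n 1≤g

greatest-maximal : ∀ p n {r} → p r ≡ true → r ≤ n → r ≤ greatest p n
greatest-maximal p n {r} pr r≤n with m≤n⇒m<n∨m≡n r≤n
greatest-maximal p (suc n) pr r≤n | inj₁ r<1+n with p (suc n)
... | true  = r≤n
... | false = greatest-maximal p n pr (s≤s⁻¹ r<1+n)
greatest-maximal p (suc n) pr r≤n | inj₂ refl rewrite pr = ≤-refl
greatest-maximal p zero pr z≤n | inj₂ refl = z≤n

count≡0⇒greatest≡0 : ∀ p n → count p n ≡ 0 → greatest p n ≡ 0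
count≡0⇒greatest≡0 p zero _ = refl
count≡0⇒greatest≡0 p (suc n) c≡0 with p (suc n)
... | false = count≡0⇒greatest≡0 p n c≡0

count-full : ∀ p {t n} → (∀ {r} → 1 ≤ r → r ≤ t → p r ≡ true) → t ≤ n → t ≤ count p n
count-full p {zero} _ _ = z≤n
count-full p {suc t} full t<n =
  ≤-trans (lemma (full (s≤s z≤n) ≤-refl)) (count-mono p t<n)
  where
  lemma : p (suc t) ≡ true → suc t ≤ count p (suc t)
  lemma p[1+t] rewrite p[1+t] = s≤s (count-full p (λ 1≤r r≤t → full 1≤r (m≤n⇒m≤1+n r≤t)) ≤-refl)

count-missing : ∀ p {a t} → p a ≡ false → 1 ≤ a → a ≤ t → count p t < t
count-missing p {a} {t} pa 1≤a a≤t with m≤n⇒m<n∨m≡n a≤t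
count-missing p {a} {suc t} pa 1≤a a≤t | inj₂ refl rewrite pa = s≤s (count≤ p t)
count-missing p {a} {suc t} pa 1≤a a≤t | inj₁ a<1+t with p (suc t)
... | true  = s≤s (count-missing p pa 1≤a (s≤s⁻¹ a<1+t))
... | false = m≤n⇒m≤1+n (count-missing p pa 1≤a (s≤s⁻¹ a<1+t))

count≤count-bound : ∀ {p t} → BoundedBy p t → ∀ n → count p n ≤ count p t
count≤count-bound {p} {t} bounded n with ≤-total n t
... | inj₁ n≤t = count-mono p n≤t
... | inj₂ t≤n = ≤-reflexive (stationary⇒constant (count p) (count-stationary bounded) t≤n)

count-complement : ∀ p n → count (λ r → not (p r)) n + count p n ≡ n
count-complement p zero = refl
count-complement p (suc n) with p (suc n)
... | true  = trans (+-suc _ _) (cong suc (count-complement p n))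
... | false = cong suc (count-complement p n)

count-gaps : ∀ p n → count (λ r → not (p r) ∧ (r <ᵇ greatest p n)) n ≡ greatest p n ∸ count p n
count-gaps p zero = refl
count-gaps p (suc n) with p (suc n)
... | true = begin
  count (λ r → not (p r) ∧ (r <ᵇ suc n)) n ≡⟨ count-cong n (λ {r} _ r≤n → cong (not (p r) ∧_) (<⇒<ᵇ≡true (s≤s r≤n))) ⟩
  count (λ r → not (p r) ∧ true) n        ≡⟨ count-cong n (λ _ _ → ∧-identityʳ _) ⟩
  count (λ r → not (p r)) n               ≡⟨ m+n∸n≡m _ (count p n) ⟨
  count (λ r → not (p r)) n + count p n ∸ count p n ≡⟨ cong (_∸ count p n) (count-complement p n) ⟩
  n ∸ count p n ∎
  where open ≡-Reasoning
... | false rewrite ≥⇒<ᵇ≡false (m≤n⇒m≤1+n (greatest≤ p n)) = count-gaps p n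

count-insert : ∀ {p q a} n → p a ≡ false → q a ≡ true → (∀ {r} → r ≢ a → q r ≡ p r) →
               1 ≤ a → a ≤ n → count q n ≡ suc (count p n)
count-insert {p} {q} {a} n pa qa q≗p 1≤a a≤n with m≤n⇒m<n∨m≡n a≤n
count-insert {p} {q} (suc n) pa qa q≗p 1≤a a≤n | inj₂ refl rewrite pa | qa =
  cong suc (count-cong n (λ _ r≤n → q≗p (<⇒≢ (s≤s r≤n))))
count-insert {p} {q} (suc n) pa qa q≗p 1≤a a≤n | inj₁ a<1+n
  rewrite q≗p (>⇒≢ a<1+n) with p (suc n)
... | true  = cong suc (count-insert n pa qa q≗p 1≤a (s≤s⁻¹ a<1+n))
... | false = count-insert n pa qa q≗p 1≤a (s≤s⁻¹ a<1+n)

count-swap : ∀ {p q a b} n → p a ≡ true → p b ≡ false → q a ≡ false → q b ≡ true →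
             (∀ {r} → r ≢ a → r ≢ b → q r ≡ p r) →
             1 ≤ a → a ≤ n → 1 ≤ b → b ≤ n → count q n ≡ count p n
count-swap {p} {q} {a} {b} n pa pb qa qb q≗p 1≤a a≤n 1≤b b≤n =
  suc-injective (trans (sym (count-insert n qa ma m≗q 1≤a a≤n)) (count-insert n pb mb m≗p 1≤b b≤n))
  where
  m : ℕ → Bool
  m r = p r ∨ (r ≡ᵇ b)
  ma : m a ≡ true
  ma rewrite pa = refl
  mb : m b ≡ true
  mb rewrite ≡⇒≡ᵇ≡true (refl {x = b}) = ∨-zeroʳ (p b)
  m≗p : ∀ {r} → r ≢ b → m r ≡ p r
  m≗p r≢b rewrite ≢⇒≡ᵇ≡false r≢b = ∨-identityʳ _
  m≗q : ∀ {r} → r ≢ a → m r ≡ q r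
  m≗q {r} r≢a with r ≟ b
  ... | yes refl = trans mb (sym qb)
  ... | no r≢b   = trans (m≗p r≢b) (sym (q≗p r≢a r≢b))

range1-suc : ∀ n → range1 (suc n) ≡ range1 n ++ suc n ∷ []
range1-suc n = trans (cong (map suc) (sym (upTo-∷ʳ n))) (map-++ suc (upTo n) (n ∷ []))

∈-range1⁺ : ∀ {n x} → 1 ≤ x → x ≤ n → x ∈ range1 n
∈-range1⁺ {x = suc i} _ i<n = ∈-map⁺ suc (∈-upTo⁺ i<n)

boolFilter-++ : ∀ {A : Set} (p : A → Bool) xs ys → boolFilter p (xs ++ ys) ≡ boolFilter p xs ++ boolFilter p ys
boolFilter-++ p []       ys = refl
boolFilter-++ p (x ∷ xs) ys with p x
... | true  = cong (x ∷_) (boolFilter-++ p xs ys)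
... | false = boolFilter-++ p xs ys

∈-boolFilter⁺ : ∀ {A : Set} (p : A → Bool) {x xs} → x ∈ xs → p x ≡ true → x ∈ boolFilter p xs
∈-boolFilter⁺ p {xs = y ∷ ys} (here refl) px rewrite px = here refl
∈-boolFilter⁺ p {xs = y ∷ ys} (there x∈) px with p y
... | true  = there (∈-boolFilter⁺ p x∈ px)
... | false = ∈-boolFilter⁺ p x∈ px

∈-boolFilter⁻ : ∀ {A : Set} (p : A → Bool) {x} xs → x ∈ boolFilter p xs → x ∈ xs × p x ≡ true
∈-boolFilter⁻ p (y ∷ ys) x∈ with p y in e | x∈
... | true  | here refl = here refl , e
... | true  | there x∈′ = let x∈ys , px = ∈-boolFilter⁻ p ys x∈′ in there x∈ys , px
... | false | x∈′       = let x∈ys , px = ∈-boolFilter⁻ p ys x∈′ in there x∈ys , px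

sum-map-boolFilter : ∀ {A : Set} (g : A → ℕ) q xs → (∀ {x} → q x ≡ false → g x ≡ 0) →
                     sum (map g (boolFilter q xs)) ≡ sum (map g xs)
sum-map-boolFilter g q []       _    = refl
sum-map-boolFilter g q (x ∷ xs) vanish with q x in e
... | true  = cong (g x +_) (sum-map-boolFilter g q xs vanish)
... | false rewrite vanish e = sum-map-boolFilter g q xs vanish

any-++ : ∀ {A : Set} (p : A → Bool) xs ys → any p (xs ++ ys) ≡ any p xs ∨ any p ys
any-++ p []       ys = refl
any-++ p (x ∷ xs) ys with p x
... | true  = refl
... | false = any-++ p xs ys

maxL-++ : ∀ xs ys → maxL (xs ++ ys) ≡ maxL xs ⊔ maxL ys
maxL-++ []       ys = refl
maxL-++ (x ∷ xs) ys = trans (cong (x ⊔_) (maxL-++ xs ys)) (sym (⊔-assoc x (maxL xs) (maxL ys)))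

∈⇒≤maxL : ∀ {x xs} → x ∈ xs → x ≤ maxL xs
∈⇒≤maxL {xs = y ∷ ys} (here refl) = m≤m⊔n y (maxL ys)
∈⇒≤maxL {xs = y ∷ ys} (there x∈) = ≤-trans (∈⇒≤maxL x∈) (m≤n⊔m y (maxL ys))

maxL-∈ : ∀ x xs → maxL (x ∷ xs) ∈ x ∷ xs
maxL-∈ x []       = here (⊔-identityʳ x)
maxL-∈ x (y ∷ ys) with ⊔-sel x (maxL (y ∷ ys))
... | inj₁ e = here e
... | inj₂ e = there (subst (_∈ y ∷ ys) (sym e) (maxL-∈ y ys))

maxL-lub : ∀ {xs k} → (∀ {x} → x ∈ xs → x ≤ k) → maxL xs ≤ k
maxL-lub {[]}     _     = z≤n
maxL-lub {x ∷ xs} bound = ⊔-lub (bound (here refl)) (maxL-lub (bound ∘′ there))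

countB≡count : ∀ p n → countB p (range1 n) ≡ count p n
countB≡count p zero    = refl
countB≡count p (suc n) = begin
  countB p (range1 (suc n))                                  ≡⟨ cong (countB p) (range1-suc n) ⟩
  length (boolFilter p (range1 n ++ suc n ∷ []))             ≡⟨ cong length (boolFilter-++ p (range1 n) _) ⟩
  length (boolFilter p (range1 n) ++ boolFilter p (suc n ∷ [])) ≡⟨ length-++ (boolFilter p (range1 n)) ⟩
  countB p (range1 n) + countB p (suc n ∷ [])                ≡⟨ cong (_+ countB p (suc n ∷ [])) (countB≡count p n) ⟩
  count p n + countB p (suc n ∷ [])                          ≡⟨ last-row ⟩
  count p (suc n)                                            ∎
  where
  open ≡-Reasoning
  last-row : count p n + countB p (suc n ∷ []) ≡ count p (suc n)
  last-row with p (suc n)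
  ... | true  = +-comm (count p n) 1
  ... | false = +-identityʳ (count p n)

maxL-boolFilter≡greatest : ∀ p n → maxL (boolFilter p (range1 n)) ≡ greatest p n
maxL-boolFilter≡greatest p zero    = refl
maxL-boolFilter≡greatest p (suc n) = begin
  maxL (boolFilter p (range1 (suc n)))                       ≡⟨ cong (maxL ∘′ boolFilter p) (range1-suc n) ⟩
  maxL (boolFilter p (range1 n ++ suc n ∷ []))               ≡⟨ cong maxL (boolFilter-++ p (range1 n) _) ⟩
  maxL (boolFilter p (range1 n) ++ boolFilter p (suc n ∷ [])) ≡⟨ maxL-++ (boolFilter p (range1 n)) _ ⟩
  maxL (boolFilter p (range1 n)) ⊔ maxL (boolFilter p (suc n ∷ [])) ≡⟨ cong (_⊔ maxL (boolFilter p (suc n ∷ []))) (maxL-boolFilter≡greatest p n) ⟩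
  greatest p n ⊔ maxL (boolFilter p (suc n ∷ []))            ≡⟨ last-row ⟩
  greatest p (suc n)                                         ∎
  where
  open ≡-Reasoning
  last-row : greatest p n ⊔ maxL (boolFilter p (suc n ∷ [])) ≡ greatest p (suc n)
  last-row with p (suc n)
  ... | true  = m≤n⇒m⊔n≡n (m≤n⇒m≤1+n (greatest≤ p n))
  ... | false = ⊔-identityʳ (greatest p n)

sum-map≡sumTo : ∀ f n → sum (map f (range1 n)) ≡ sumTo f n
sum-map≡sumTo f zero    = refl
sum-map≡sumTo f (suc n) = begin
  sum (map f (range1 (suc n)))                  ≡⟨ cong (sum ∘′ map f) (range1-suc n) ⟩
  sum (map f (range1 n ++ suc n ∷ []))          ≡⟨ cong sum (map-++ f (range1 n) _) ⟩
  sum (map f (range1 n) ++ f (suc n) ∷ [])      ≡⟨ sum-++ (map f (range1 n)) _ ⟩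
  sum (map f (range1 n)) + (f (suc n) + 0)      ≡⟨ cong₂ _+_ (sum-map≡sumTo f n) (+-identityʳ (f (suc n))) ⟩
  sumTo f (suc n)                               ∎
  where open ≡-Reasoning

any-above≡<ᵇgreatest : ∀ p r n → any (λ s → (r <ᵇ s) ∧ p s) (range1 n) ≡ (r <ᵇ greatest p n)
any-above≡<ᵇgreatest p r zero    = refl
any-above≡<ᵇgreatest p r (suc n) = begin
  any above (range1 (suc n))                         ≡⟨ cong (any above) (range1-suc n) ⟩
  any above (range1 n ++ suc n ∷ [])                 ≡⟨ any-++ above (range1 n) _ ⟩
  any above (range1 n) ∨ any above (suc n ∷ [])      ≡⟨ cong (_∨ any above (suc n ∷ [])) (any-above≡<ᵇgreatest p r n) ⟩
  (r <ᵇ greatest p n) ∨ any above (suc n ∷ [])       ≡⟨ last-row ⟩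
  (r <ᵇ greatest p (suc n))                          ∎
  where
  open ≡-Reasoning
  above : ℕ → Bool
  above s = (r <ᵇ s) ∧ p s
  last-row : (r <ᵇ greatest p n) ∨ any above (suc n ∷ []) ≡ (r <ᵇ greatest p (suc n))
  last-row with p (suc n)
  ... | false rewrite ∧-zeroʳ (r <ᵇ suc n) = ∨-identityʳ _
  ... | true with r <ᵇ greatest p n in r<g
  ...   | true  = sym (<⇒<ᵇ≡true (<-≤-trans (<ᵇ≡true⇒< r<g) (m≤n⇒m≤1+n (greatest≤ p n))))
  ...   | false = trans (∨-identityʳ _) (∧-identityʳ _)

-- Cells, columns and slides

mem⇒∈ : ∀ F {r c} → mem F r c ≡ true → (r , c) ∈ F
mem⇒∈ ((a , b) ∷ F) {r} {c} m with a ≡ᵇ r in a≡r | b ≡ᵇ c in b≡c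
... | true  | true  = here (cong₂ _,_ (sym (≡ᵇ≡true⇒≡ a≡r)) (sym (≡ᵇ≡true⇒≡ b≡c)))
... | true  | false = there (mem⇒∈ F m)
... | false | _     = there (mem⇒∈ F m)

∈⇒mem : ∀ F {r c} → (r , c) ∈ F → mem F r c ≡ true
∈⇒mem _ {r} {c} (here refl) rewrite ≡⇒≡ᵇ≡true (refl {x = r}) | ≡⇒≡ᵇ≡true (refl {x = c}) = refl
∈⇒mem (_ ∷ F) (there x∈) rewrite ∈⇒mem F x∈ = ∨-zeroʳ _

∈⇒≤bnd : ∀ {F r c} → (r , c) ∈ F → r ≤ bnd F × c ≤ bnd F
∈⇒≤bnd {(a , b) ∷ F} (here refl) =
  ≤-trans (m≤m⊔n a b) (m≤m⊔n (a ⊔ b) (bnd F)) , ≤-trans (m≤n⊔m a b) (m≤m⊔n (a ⊔ b) (bnd F))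
∈⇒≤bnd {(a , b) ∷ F} (there x∈) =
  let r≤ , c≤ = ∈⇒≤bnd x∈ in ≤-trans r≤ (m≤n⊔m (a ⊔ b) (bnd F)) , ≤-trans c≤ (m≤n⊔m (a ⊔ b) (bnd F))

columnOf : Diagram → ℕ → ℕ → Bool
columnOf F c r = mem F r c

emptyCount≡sumTo-gaps : ∀ E b → (∀ {r c} → mem E r c ≡ true → r ≤ b × c ≤ b) →
                        emptyCount E ≡ sumTo (λ c → gaps (columnOf E c) b) b
emptyCount≡sumTo-gaps E b bounded = begin
  emptyCount E
    ≡⟨ sum-map≡sumTo _ (bnd E) ⟩
  sumTo (λ c → countB (λ r → isEmptyCell E r c) (range1 (bnd E))) (bnd E)
    ≡⟨ sumTo-cong (bnd E) column-gaps ⟩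
  sumTo (λ c → gaps (columnOf E c) (bnd E)) (bnd E)
    ≡⟨ sumTo-cong (bnd E) bound-irrelevant ⟩
  sumTo (λ c → gaps (columnOf E c) b) (bnd E)
    ≡⟨ stationary-agree (sumTo (λ c → gaps (columnOf E c) b))
         (sumTo-stationary (beyond (λ m → proj₂ (∈⇒≤bnd (mem⇒∈ E m)))))
         (sumTo-stationary (beyond (λ m → proj₂ (bounded m)))) ⟩
  sumTo (λ c → gaps (columnOf E c) b) b
    ∎
  where
  open ≡-Reasoning
  column-gaps : ∀ c → countB (λ r → isEmptyCell E r c) (range1 (bnd E)) ≡ gaps (columnOf E c) (bnd E)
  column-gaps c = begin
    countB (λ r → isEmptyCell E r c) (range1 (bnd E))
      ≡⟨ countB≡count _ (bnd E) ⟩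
    count (λ r → isEmptyCell E r c) (bnd E)
      ≡⟨ count-cong (bnd E) (λ {r} _ _ → cong (not (mem E r c) ∧_) (any-above≡<ᵇgreatest (columnOf E c) r (bnd E))) ⟩
    count (λ r → not (mem E r c) ∧ (r <ᵇ greatest (columnOf E c) (bnd E))) (bnd E)
      ≡⟨ count-gaps (columnOf E c) (bnd E) ⟩
    gaps (columnOf E c) (bnd E)
      ∎
  bound-irrelevant : ∀ c → gaps (columnOf E c) (bnd E) ≡ gaps (columnOf E c) b
  bound-irrelevant c = stationary-agree (gaps (columnOf E c))
    (gaps-stationary (λ m → proj₁ (∈⇒≤bnd (mem⇒∈ E m)))) (gaps-stationary (λ m → proj₁ (bounded m)))
  beyond : ∀ {b′} → (∀ {r c} → mem E r c ≡ true → c ≤ b′) → ∀ {c} → b′ < c → gaps (columnOf E c) b ≡ 0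
  beyond columns≤b′ {c} b′<c =
    stationary⇒constant (gaps (columnOf E c)) (gaps-stationary (λ m → ⊥-elim (<⇒≱ b′<c (columns≤b′ m)))) (z≤n {b})

slide : ℕ → ℕ → ℕ → Diagram → Diagram
slide t r′ c F = moveCell F t c (just r′)

notAt : ℕ → ℕ → Cell → Bool
notAt t c x = not ((proj₁ x ≡ᵇ t) ∧ (proj₂ x ≡ᵇ c))

notAt-≢ : ∀ {t c r₀ c₀} → (r₀ , c₀) ≢ (t , c) → notAt t c (r₀ , c₀) ≡ true
notAt-≢ {t} {c} {r₀} {c₀} ne with r₀ ≡ᵇ t in r₀≡t | c₀ ≡ᵇ c in c₀≡c
... | true  | true  = ⊥-elim (ne (cong₂ _,_ (≡ᵇ≡true⇒≡ r₀≡t) (≡ᵇ≡true⇒≡ c₀≡c)))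
... | true  | false = refl
... | false | _     = refl

notAt-self : ∀ t c → notAt t c (t , c) ≡ false
notAt-self t c rewrite ≡⇒≡ᵇ≡true (refl {x = t}) | ≡⇒≡ᵇ≡true (refl {x = c}) = refl

mem-slide-target : ∀ t r′ c F → mem (slide t r′ c F) r′ c ≡ true
mem-slide-target t r′ c F = ∈⇒mem (slide t r′ c F) (here refl)

mem-slide⁻ : ∀ {t r′ c r₀ c₀} F → mem (slide t r′ c F) r₀ c₀ ≡ true →
             (r₀ , c₀) ≡ (r′ , c) ⊎ mem F r₀ c₀ ≡ true
mem-slide⁻ {t} {c = c} F m with mem⇒∈ (slide t _ c F) m
... | here e   = inj₁ e
... | there x∈ = inj₂ (∈⇒mem F (proj₁ (∈-boolFilter⁻ (notAt t c) F x∈)))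

mem-slide-source : ∀ {t r′ c} F → r′ ≢ t → mem (slide t r′ c F) t c ≡ false
mem-slide-source {t} {r′} {c} F r′≢t = ¬-not source∉
  where
  source∉ : mem (slide t r′ c F) t c ≢ true
  source∉ m with mem⇒∈ (slide t r′ c F) m
  ... | here e   = r′≢t (sym (cong proj₁ e))
  ... | there x∈ with () ← trans (sym (proj₂ (∈-boolFilter⁻ (notAt t c) F x∈))) (notAt-self t c)

mem-slide-other : ∀ {t r′ c r₀ c₀} F → (r₀ , c₀) ≢ (r′ , c) → (r₀ , c₀) ≢ (t , c) →
                  mem (slide t r′ c F) r₀ c₀ ≡ mem F r₀ c₀
mem-slide-other {t} {r′} {c} {r₀} {c₀} F ≢target ≢source with mem F r₀ c₀ in e
... | true  = ∈⇒mem (slide t r′ c F) (there (∈-boolFilter⁺ (notAt t c) (mem⇒∈ F e) (notAt-≢ ≢source)))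
... | false = ¬-not λ m → case mem-slide⁻ F m of λ
  { (inj₁ eq) → ≢target eq
  ; (inj₂ m′) → case trans (sym m′) e of λ () }

rowSum : Diagram → ℕ
rowSum F = sum (map proj₁ F)

rowSum-boolFilter : ∀ p F → rowSum (boolFilter p F) ≤ rowSum F
rowSum-boolFilter p []      = z≤n
rowSum-boolFilter p (x ∷ F) with p x
... | true  = +-monoʳ-≤ (proj₁ x) (rowSum-boolFilter p F)
... | false = ≤-trans (rowSum-boolFilter p F) (m≤n+m (rowSum F) (proj₁ x))

rowSum-boolFilter-drop : ∀ p {x F} → x ∈ F → p x ≡ false → rowSum (boolFilter p F) + proj₁ x ≤ rowSum F
rowSum-boolFilter-drop p {x} {F = x ∷ F} (here refl) px rewrite px =
  ≤-trans (≤-reflexive (+-comm (rowSum (boolFilter p F)) (proj₁ x))) (+-monoʳ-≤ (proj₁ x) (rowSum-boolFilter p F))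
rowSum-boolFilter-drop p {x} {F = y ∷ F} (there x∈) px with p y
... | true  = ≤-trans (≤-reflexive (+-assoc (proj₁ y) _ (proj₁ x))) (+-monoʳ-≤ (proj₁ y) (rowSum-boolFilter-drop p x∈ px))
... | false = ≤-trans (rowSum-boolFilter-drop p x∈ px) (m≤n+m (rowSum F) (proj₁ y))

rowSum-slide : ∀ {t r′ c} F → mem F t c ≡ true → r′ < t → rowSum (slide t r′ c F) < rowSum F
rowSum-slide {t} {r′} {c} F m r′<t = begin-strict
  r′ + rowSum rest  <⟨ +-monoˡ-< (rowSum rest) r′<t ⟩
  t + rowSum rest   ≡⟨ +-comm t (rowSum rest) ⟩
  rowSum rest + t   ≤⟨ rowSum-boolFilter-drop (notAt t c) (mem⇒∈ F m) (notAt-self t c) ⟩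
  rowSum F          ∎
  where
  open ≤-Reasoning
  rest = boolFilter (notAt t c) F

-- Kohnert moves

∈-rowCols⁺ : ∀ F s {c} → mem F s c ≡ true → c ∈ rowCols F s
∈-rowCols⁺ F s m = ∈-map⁺ proj₂ (∈-boolFilter⁺ _ (mem⇒∈ F m) (≡⇒≡ᵇ≡true (refl {x = s})))

∈-rowCols⁻ : ∀ F s {c} → c ∈ rowCols F s → mem F s c ≡ true
∈-rowCols⁻ F s c∈ with ∈-map⁻ proj₂ c∈
... | (r , c) , x∈ , refl with ∈-boolFilter⁻ _ F x∈
...   | x∈F , r≡s = subst (λ r → mem F r c ≡ true) (≡ᵇ≡true⇒≡ r≡s) (∈⇒mem F x∈F)

record Rightmost (F : Diagram) (s c : ℕ) : Set where
  field
    occupied : mem F s c ≡ true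
    maximal  : ∀ {c′} → mem F s c′ ≡ true → c′ ≤ c

rowCols-rightmost : ∀ F s {x xs} → rowCols F s ≡ x ∷ xs → Rightmost F s (maxL (x ∷ xs))
rowCols-rightmost F s {x} {xs} e = record
  { occupied = ∈-rowCols⁻ F s (subst (maxL (x ∷ xs) ∈_) (sym e) (maxL-∈ x xs))
  ; maximal  = λ m → subst (λ cs → _ ≤ maxL cs) e (∈⇒≤maxL (∈-rowCols⁺ F s m))
  }

rowCols-[] : ∀ F s {c} → rowCols F s ≡ [] → mem F s c ≡ false
rowCols-[] F s {c} e = ¬-not (λ m → ¬Any[] (subst (c ∈_) e (∈-rowCols⁺ F s m)))

findFree-just : ∀ F c k {r′} → findFree F c k ≡ just r′ →
                1 ≤ r′ × r′ ≤ k × mem F r′ c ≡ false × (∀ {u} → r′ < u → u ≤ k → mem F u c ≡ true)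
findFree-just F c (suc k) e with mem F (suc k) c in m
findFree-just F c (suc k) refl | false = s≤s z≤n , ≤-refl , m , λ r′<u u≤r′ → ⊥-elim (<⇒≱ r′<u u≤r′)
findFree-just F c (suc k) {r′} e | true with findFree-just F c k e
... | 1≤r′ , r′≤k , free , filled = 1≤r′ , m≤n⇒m≤1+n r′≤k , free , filled′
  where
  filled′ : ∀ {u} → r′ < u → u ≤ suc k → mem F u c ≡ true
  filled′ r′<u u≤1+k with m≤n⇒m<n∨m≡n u≤1+k
  ... | inj₁ u<1+k = filled r′<u (s≤s⁻¹ u<1+k)
  ... | inj₂ refl  = m

findFree-nothing : ∀ F c k → findFree F c k ≡ nothing → ∀ {u} → 1 ≤ u → u ≤ k → mem F u c ≡ true
findFree-nothing F c zero _ 1≤u u≤0 = ⊥-elim (<⇒≱ 1≤u u≤0)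
findFree-nothing F c (suc k) e 1≤u u≤1+k with mem F (suc k) c in m | m≤n⇒m<n∨m≡n u≤1+k
... | true | inj₁ u<1+k = findFree-nothing F c k e 1≤u (s≤s⁻¹ u<1+k)
... | true | inj₂ refl  = m

data Stuck (F : Diagram) (s : ℕ) : Set where
  row-empty   : (∀ {c} → mem F s c ≡ false) → Stuck F s
  column-full : ∀ {c} → Rightmost F s c → (∀ {u} → 1 ≤ u → u < s → mem F u c ≡ true) → Stuck F s

record Slide (F : Diagram) (s : ℕ) : Set where
  field
    col                 : ℕ
    target              : ℕ
    rightmost           : Rightmost F s col
    1≤target            : 1 ≤ target
    target<s            : target < s
    target-free         : mem F target col ≡ false
    filled-above-target : ∀ {u} → target < u → u < s → mem F u col ≡ true
    K≡slide             : K F s ≡ slide s target col F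

K-slide : ∀ F s {x xs r′} → rowCols F s ≡ x ∷ xs → findFree F (maxL (x ∷ xs)) (pred s) ≡ just r′ →
          K F s ≡ slide s r′ (maxL (x ∷ xs)) F
K-slide F s cols free with rowCols F s | cols
... | _ | refl rewrite free = refl

kohnert-view : ∀ F s → (Stuck F s × K F s ≡ F) ⊎ Slide F s
kohnert-view F s with rowCols F s in cols
... | [] = inj₁ (row-empty (rowCols-[] F s cols) , refl)
... | x ∷ xs with findFree F (maxL (x ∷ xs)) (pred s) in free
...   | nothing = inj₁ (column-full (rowCols-rightmost F s cols) full , refl)
  where
  full : ∀ {u} → 1 ≤ u → u < s → mem F u (maxL (x ∷ xs)) ≡ true
  full 1≤u u<s = findFree-nothing F _ (pred s) free 1≤u (<⇒≤pred u<s)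
...   | just r′ = let 1≤r′ , r′≤pred[s] , r′-free , filled = findFree-just F _ (pred s) free in inj₂ record
  { col                 = maxL (x ∷ xs)
  ; target              = r′
  ; rightmost           = rowCols-rightmost F s cols
  ; 1≤target            = 1≤r′
  ; target<s            = 1≤m≤pred[n]⇒m<n 1≤r′ r′≤pred[s]
  ; target-free         = r′-free
  ; filled-above-target = λ r′<u u<s → filled r′<u (<⇒≤pred u<s)
  ; K≡slide             = K-slide F s cols free
  }

IsMin⇒stuck : ∀ {E} → IsMin E → ∀ s → Stuck E s
IsMin⇒stuck {E} min s with kohnert-view E s
... | inj₁ (stuck , _) = stuck
... | inj₂ m = case trans (sym source-kept) (mem-slide-source E (<⇒≢ target<s)) of λ ()
  where
  open Slide m
  source-kept : mem (slide s target col E) s col ≡ true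
  source-kept = trans (cong (λ X → mem X s col) (sym K≡slide)) (trans (min s s col) (Rightmost.occupied rightmost))

module ColumnHeights (D : Diagram) where

  B : ℕ
  B = bnd D

  colCount≡count : ∀ c → colCount D c ≡ count (columnOf D c) B
  colCount≡count c = countB≡count (columnOf D c) B

  topRow≡greatest : ∀ c → topRow D c ≡ greatest (columnOf D c) B
  topRow≡greatest c = maxL-boolFilter≡greatest (columnOf D c) B

  topRow≤B : ∀ c → topRow D c ≤ B
  topRow≤B c = subst (_≤ B) (sym (topRow≡greatest c)) (greatest≤ (columnOf D c) B)

  h≡topRow⊓[colCount⊔maxRight] : ∀ c → h D c ≡ topRow D c ⊓ (colCount D c ⊔ maxRight D c)
  h≡topRow⊓[colCount⊔maxRight] c = h-formula (subst₂ _≤_ (sym (colCount≡count c)) (sym (topRow≡greatest c))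
                                                        (count≤greatest (columnOf D c) B))

  h≤topRow : ∀ c → h D c ≤ topRow D c
  h≤topRow c = subst (_≤ topRow D c) (sym (h≡topRow⊓[colCount⊔maxRight] c)) (m⊓n≤m _ _)

  h≤colCount⊔maxRight : ∀ c → h D c ≤ colCount D c ⊔ maxRight D c
  h≤colCount⊔maxRight c = subst (_≤ colCount D c ⊔ maxRight D c) (sym (h≡topRow⊓[colCount⊔maxRight] c)) (m⊓n≤n _ _)

  colCount≤maxRight : ∀ {c c′} → c < c′ → c′ ≤ B → colCount D c′ ≤ maxRight D c
  colCount≤maxRight c<c′ c′≤B = ∈⇒≤maxL (∈-map⁺ (colCount D)
    (∈-boolFilter⁺ _ (∈-range1⁺ (≤-trans (s≤s z≤n) c<c′) c′≤B) (<⇒<ᵇ≡true c<c′)))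

  maxRight≤ : ∀ {c k} → (∀ {c′} → c < c′ → colCount D c′ ≤ k) → maxRight D c ≤ k
  maxRight≤ {c} bound = maxL-lub λ y∈ → case ∈-map⁻ (colCount D) y∈ of λ
    { (c′ , c′∈ , refl) → bound (<ᵇ≡true⇒< (proj₂ (∈-boolFilter⁻ (c <ᵇ_) (range1 B) c′∈))) }

  record Admissible (F : Diagram) : Set where
    field
      column≤B           : ∀ {r c} → mem F r c ≡ true → c ≤ B
      row≤topRow         : ∀ {r c} → mem F r c ≡ true → r ≤ topRow D c
      colCount-preserved : ∀ c → count (columnOf F c) B ≡ colCount D c

    row≤B : ∀ {r c} → mem F r c ≡ true → r ≤ B
    row≤B {c = c} m = ≤-trans (row≤topRow m) (topRow≤B c)

  open Admissible

  admissible-D : Admissible D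
  admissible-D = record
    { column≤B           = λ m → proj₂ (∈⇒≤bnd (mem⇒∈ D m))
    ; row≤topRow         = λ {r} {c} m → subst (r ≤_) (sym (topRow≡greatest c))
                             (greatest-maximal (columnOf D c) B m (proj₁ (∈⇒≤bnd (mem⇒∈ D m))))
    ; colCount-preserved = λ c → sym (colCount≡count c)
    }

  admissible-slide : ∀ {F t r′ c} → Admissible F → mem F t c ≡ true → 1 ≤ r′ → r′ < t → mem F r′ c ≡ false →
                     Admissible (slide t r′ c F)
  admissible-slide {F} {t} {r′} {c} A source 1≤r′ r′<t free = record
    { column≤B           = λ m → case mem-slide⁻ {t} {r′} {c} F m of λ
                             { (inj₁ refl) → column≤B A source ; (inj₂ m′) → column≤B A m′ }
    ; row≤topRow         = λ m → case mem-slide⁻ {t} {r′} {c} F m of λ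
                             { (inj₁ refl) → ≤-trans (<⇒≤ r′<t) (row≤topRow A source) ; (inj₂ m′) → row≤topRow A m′ }
    ; colCount-preserved = λ c₀ → trans (same-count c₀) (colCount-preserved A c₀)
    }
    where
    same-count : ∀ c₀ → count (columnOf (slide t r′ c F) c₀) B ≡ count (columnOf F c₀) B
    same-count c₀ with c₀ ≟ c
    ... | no c₀≢c = count-cong B λ _ _ → mem-slide-other {t} {r′} {c} F (c₀≢c ∘′ cong proj₂) (c₀≢c ∘′ cong proj₂)
    ... | yes refl = count-swap B source free (mem-slide-source F (<⇒≢ r′<t)) (mem-slide-target t r′ c F)
                       (λ r≢t r≢r′ → mem-slide-other {t} {r′} {c} F (r≢r′ ∘′ cong proj₁) (r≢t ∘′ cong proj₁))
                       (≤-trans 1≤r′ (<⇒≤ r′<t)) (row≤B A source) 1≤r′ (≤-trans (<⇒≤ r′<t) (row≤B A source))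

  admissible-along : ∀ {F s} → Admissible F → (m : Slide F s) → Admissible (slide s (Slide.target m) (Slide.col m) F)
  admissible-along A m = admissible-slide A (Rightmost.occupied rightmost) 1≤target target<s target-free
    where open Slide m

  admissible-K : ∀ {F} → Admissible F → ∀ s → Admissible (K F s)
  admissible-K {F} A s with kohnert-view F s
  ... | inj₁ (_ , K≡F) = subst Admissible (sym K≡F) A
  ... | inj₂ m         = subst Admissible (sym (Slide.K≡slide m)) (admissible-along A m)

  reach⇒admissible : ∀ {E} → Reach D E → Admissible E
  reach⇒admissible here         = admissible-D
  reach⇒admissible (step D↝E s) = admissible-K (reach⇒admissible D↝E) s

  stuck-above-B : ∀ {F} → Admissible F → ∀ {s} → B < s → Stuck F s × K F s ≡ F
  stuck-above-B {F} A {s} B<s with kohnert-view F s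
  ... | inj₁ fixed = fixed
  ... | inj₂ m     = ⊥-elim (<⇒≱ B<s (row≤B A (Rightmost.occupied (Slide.rightmost m))))

  height : Diagram → ℕ → ℕ
  height F c = greatest (columnOf F c) B

  colCount≤colCount⊔maxRight : ∀ {c c′} → c ≤ c′ → c′ ≤ B → colCount D c′ ≤ colCount D c ⊔ maxRight D c
  colCount≤colCount⊔maxRight c≤c′ c′≤B with m≤n⇒m<n∨m≡n c≤c′
  ... | inj₁ c<c′ = ≤-trans (colCount≤maxRight c<c′ c′≤B) (m≤n⊔m _ _)
  ... | inj₂ refl = m≤m⊔n _ _

  full-column⇒≤colCount : ∀ {E T c} → Admissible E → Rightmost E T c →
                          (∀ {u} → 1 ≤ u → u < T → mem E u c ≡ true) → T ≤ colCount D c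
  full-column⇒≤colCount {E} {T} {c} A rm full =
    subst (T ≤_) (colCount-preserved A c) (count-full (columnOf E c) filled (row≤B A occupied))
    where
    open Rightmost rm
    filled : ∀ {u} → 1 ≤ u → u ≤ T → mem E u c ≡ true
    filled 1≤u u≤T with m≤n⇒m<n∨m≡n u≤T
    ... | inj₁ u<T  = full 1≤u u<T
    ... | inj₂ refl = occupied

  occupied⇒≤h : ∀ {E T c} → Admissible E → (∀ s → Stuck E s) → mem E T c ≡ true → T ≤ h D c
  occupied⇒≤h {E} {T} {c} A stuck m =
    subst (T ≤_) (sym (h≡topRow⊓[colCount⊔maxRight] c)) (⊓-glb (row≤topRow A m) (≤colCount⊔maxRight (stuck T)))
    where
    ≤colCount⊔maxRight : Stuck E T → T ≤ colCount D c ⊔ maxRight D c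
    ≤colCount⊔maxRight (row-empty empty)    = case trans (sym m) empty of λ ()
    ≤colCount⊔maxRight (column-full rm full) = ≤-trans (full-column⇒≤colCount A rm full)
      (colCount≤colCount⊔maxRight (Rightmost.maximal rm m) (column≤B A (Rightmost.occupied rm)))

  height≤h : ∀ {E} → Admissible E → (∀ s → Stuck E s) → ∀ c → height E c ≤ h D c
  height≤h {E} A stuck c with 1 ≤? height E c
  ... | yes 1≤height = occupied⇒≤h A stuck (greatest-holds (columnOf E c) B 1≤height)
  ... | no  height≱1 = ≤-trans (≤-reflexive (n<1⇒n≡0 (≰⇒> height≱1))) z≤n

  Reaches-h : Diagram → Set
  Reaches-h F = ∀ {c} → 1 ≤ h D c → ∃[ s ] h D c ≤ s × mem F s c ≡ true

  h≤height : ∀ {E} → Admissible E → Reaches-h E → ∀ c → h D c ≤ height E c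
  h≤height {E} A reach c with 1 ≤? h D c
  ... | yes 1≤h = let s , h≤s , m = reach 1≤h in ≤-trans h≤s (greatest-maximal (columnOf E c) B m (row≤B A m))
  ... | no  h≱1 = ≤-trans (≤-reflexive (n<1⇒n≡0 (≰⇒> h≱1))) z≤n

  reaches-h-D : Reaches-h D
  reaches-h-D {c} 1≤h = topRow D c , h≤topRow c , subst (λ r → mem D r c ≡ true) (sym (topRow≡greatest c))
    (greatest-holds (columnOf D c) B (subst (1 ≤_) (topRow≡greatest c) (≤-trans 1≤h (h≤topRow c))))

  module _ {F t} (A : Admissible F) (m : Slide F t) (stuck-above : ∀ {s} → t < s → Stuck F s) where
    open Slide m
    open Rightmost rightmost

    -- A stuck row s > t with a cell in a column ≥ col has its rightmost column full
    -- below s; that column meets row t, so it is col, and target would be filled.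
    right-columns-below-source : ∀ {s c′} → col ≤ c′ → mem F s c′ ≡ true → s ≤ t
    right-columns-below-source {s} {c′} col≤c′ m′ with s ≤? t
    ... | yes s≤t = s≤t
    ... | no  s≰t with stuck-above (≰⇒> s≰t)
    ...   | row-empty empty = case trans (sym m′) empty of λ ()
    ...   | column-full {cs} rm full = case trans (sym target-filled) target-free of λ ()
      where
      t<s = ≰⇒> s≰t
      cs≡col : cs ≡ col
      cs≡col = ≤-antisym (maximal (full (≤-trans 1≤target (<⇒≤ target<s)) t<s))
                         (≤-trans col≤c′ (Rightmost.maximal rm m′))
      target-filled : mem F target col ≡ true
      target-filled = subst (λ c → mem F target c ≡ true) cs≡col (full 1≤target (<-trans target<s t<s))

    colCount≤pred-source : ∀ {c′} → col ≤ c′ → ∀ {a} → mem F a c′ ≡ false → 1 ≤ a → a ≤ t → colCount D c′ ≤ pred t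
    colCount≤pred-source {c′} col≤c′ free 1≤a a≤t = subst (_≤ pred t) (colCount-preserved A c′)
      (<⇒≤pred (≤-<-trans (count≤count-bound (right-columns-below-source col≤c′) B) (count-missing (columnOf F c′) free 1≤a a≤t)))

    h≤pred-source : h D col ≤ pred t
    h≤pred-source = ≤-trans (h≤colCount⊔maxRight col) (⊔-lub
      (colCount≤pred-source ≤-refl target-free 1≤target (<⇒≤ target<s))
      (maxRight≤ λ col<c′ → colCount≤pred-source (<⇒≤ col<c′) (¬-not λ m′ → <⇒≱ col<c′ (maximal m′))
                              (≤-trans 1≤target (<⇒≤ target<s)) ≤-refl))

    reaches-h-slide : Reaches-h F → Reaches-h (slide t target col F)
    reaches-h-slide reach {c₀} 1≤h with reach 1≤h
    ... | s , h≤s , m′ with s ≟ t | c₀ ≟ col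
    ...   | yes refl | yes refl = pred t , h≤pred-source , below-source-filled
      where
      pred-t<t = pred[n]<n target<s
      below-source-filled : mem (slide t target col F) (pred t) col ≡ true
      below-source-filled with target ≟ pred t
      ... | yes target≡pred-t = subst (λ r → mem (slide t target col F) r col ≡ true) target≡pred-t
                                      (mem-slide-target t target col F)
      ... | no  target≢pred-t = trans
        (mem-slide-other {t} {target} {col} F (target≢pred-t ∘′ sym ∘′ cong proj₁) (<⇒≢ pred-t<t ∘′ cong proj₁))
        (filled-above-target (≤∧≢⇒< (<⇒≤pred target<s) target≢pred-t) pred-t<t)
    ...   | yes refl | no c₀≢col =
      s , h≤s , trans (mem-slide-other {t} {target} {col} F (c₀≢col ∘′ cong proj₂) (c₀≢col ∘′ cong proj₂)) m′
    ...   | no s≢t   | _ = s , h≤s , trans (mem-slide-other {t} {target} {col} F not-target (s≢t ∘′ cong proj₁)) m′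
      where
      not-target : (s , c₀) ≢ (target , col)
      not-target refl = case trans (sym m′) target-free of λ ()

  descend : ∀ {F} → Acc _<_ (rowSum F) → Reach D F → Admissible F → Reaches-h F →
            ∃[ E ] Reach D E × IsMin E × Admissible E × Reaches-h E
  descend {F} (acc smaller) D↝F A reach with everywhere⊎highest (kohnert-view F) B (stuck-above-B A)
  ... | inj₁ fixed = F , D↝F , (λ s r c → cong (λ X → mem X r c) (proj₂ (fixed s))) , A , reach
  ... | inj₂ (t , m , fixed-above) =
    descend (smaller (rowSum-slide F occupied target<s)) (subst (Reach D) K≡slide (step D↝F t))
            (admissible-along A m) (reaches-h-slide A m (proj₁ ∘′ fixed-above) reach)
    where
    open Slide m
    open Rightmost rightmost

  minimal-descendant : ∃[ E ] Reach D E × IsMin E × Admissible E × Reaches-h E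
  minimal-descendant = descend (<-wellFounded (rowSum D)) here admissible-D reaches-h-D

  columnGaps : Diagram → ℕ → ℕ
  columnGaps E c = gaps (columnOf E c) B

  columnGaps≤ : ∀ {E} → Admissible E → IsMin E → ∀ c → columnGaps E c ≤ h D c ∸ colCount D c
  columnGaps≤ A min c rewrite colCount-preserved A c = ∸-monoˡ-≤ (colCount D c) (height≤h A (IsMin⇒stuck min) c)

  columnGaps≡ : ∀ {E} → Admissible E → IsMin E → Reaches-h E → ∀ c → columnGaps E c ≡ h D c ∸ colCount D c
  columnGaps≡ A min reach c =
    cong₂ _∸_ (≤-antisym (height≤h A (IsMin⇒stuck min) c) (h≤height A reach c)) (colCount-preserved A c)

  emptyCount≡sumTo-columnGaps : ∀ {E} → Admissible E → emptyCount E ≡ sumTo (columnGaps E) B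
  emptyCount≡sumTo-columnGaps {E} A = emptyCount≡sumTo-gaps E B λ m → row≤B A m , column≤B A m

  hSum≡sumTo : hSum D ≡ sumTo (λ c → h D c ∸ colCount D c) B
  hSum≡sumTo = trans (sum-map-boolFilter _ _ (range1 B) empty-column) (sum-map≡sumTo _ B)
    where
    empty-column : ∀ {c} → (1 ≤ᵇ colCount D c) ≡ false → h D c ∸ colCount D c ≡ 0
    empty-column {c} no-cells =
      n≤0⇒n≡0 (≤-trans (m∸n≤m (h D c) (colCount D c)) (≤-trans (h≤topRow c) (≤-reflexive topRow≡0)))
      where
      topRow≡0 : topRow D c ≡ 0
      topRow≡0 = trans (topRow≡greatest c) (count≡0⇒greatest≡0 (columnOf D c) B
                   (trans (sym (colCount≡count c)) (n<1⇒n≡0 (≤ᵇ≡false⇒> no-cells))))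

theorem4p6 : (D : Diagram) → Positive D →
    (Σ Diagram (λ E → Reach D E × IsMin E × emptyCount E ≡ hSum D))
    × ((E : Diagram) → Reach D E → IsMin E → emptyCount E ≤ hSum D)
theorem4p6 D _ = attained minimal-descendant , bounded
  where
  open ColumnHeights D

  attained : ∃[ E ] Reach D E × IsMin E × Admissible E × Reaches-h E →
             Σ Diagram (λ E → Reach D E × IsMin E × emptyCount E ≡ hSum D)
  attained (E , D↝E , min , A , reach) = E , D↝E , min , (begin
    emptyCount E                         ≡⟨ emptyCount≡sumTo-columnGaps A ⟩
    sumTo (columnGaps E) B               ≡⟨ sumTo-cong B (columnGaps≡ A min reach) ⟩
    sumTo (λ c → h D c ∸ colCount D c) B ≡⟨ hSum≡sumTo ⟨
    hSum D                               ∎)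
    where open ≡-Reasoning

  bounded : (E : Diagram) → Reach D E → IsMin E → emptyCount E ≤ hSum D
  bounded E D↝E min = begin
    emptyCount E                         ≡⟨ emptyCount≡sumTo-columnGaps A ⟩
    sumTo (columnGaps E) B               ≤⟨ sumTo-mono B (columnGaps≤ A min) ⟩
    sumTo (λ c → h D c ∸ colCount D c) B ≡⟨ hSum≡sumTo ⟨
    hSum D                               ∎
    where
    open ≤-Reasoning
    A = reach⇒admissible D↝E
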